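{- Let $n\geq 3$ and let $v$ be a starting node of the ring of size $n$. Every exploration algorithm of class $\mathcal{A}_0$ has overhead at least $\frac{2n-3}{n}$.
   Context: Exploration model: a graph is simple, connected, undirected, with distinct node labels and ports $1,\dots,d$ at each node of degree $d$. A mobile agent starts at node $v$ with a complete labeled map. A fault configuration is a set $F$ of faulty edges, unknown to the agent; faulty edges cannot be traversed, and on first visiting a node the agent learns which incident ports are faulty (others are free). $C$ is the connected component of $v$ in the graph with faulty edges removed; exploration is finished when the last node of $C$ is visited. The cost $\mathcal{C}(A,F)$ is the number of edge traversals; $opt(F)$ is the minimum number of traversals needed to visit all nodes of $C$ from $v$ knowing $F$; the overhead is $\mathcal{O}_A=\max_F \mathcal{C}(A,F)/opt(F)$ (ratio $1$ when $C=\{v\}$). The ring of size $n$ has nodes $v_1,\dots,v_n$ and edges $\{v_i,v_{i+1}\}$, $\{v_n,v_1\}$; port $\ell$ leads to the predecessor and port $r$ to the successor of each node. An algorithm of class $\mathcal{A}_0$ fixes a direction $d\in\{\ell,r\}$; the agent repeatedly takes port $d$ until port $d$ at the current node is faulty or all $n$ nodes have been visited; then, if unvisited nodes of $C$ remain, it repeatedly takes the opposite port until that port at the current node is faulty or all nodes have been visited. -}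

module Defs where

open import Data.Nat using (ℕ; zero; suc; _+_; _*_; _∸_; _≤_; _<_)
open import Data.Nat.DivMod using (_%_; m%n<n)
open import Data.Fin using (Fin; zero; suc; toℕ; fromℕ; fromℕ<; inject₁)
open import Data.Fin.Properties using (_≟_)
open import Data.Bool using (Bool; true; false; if_then_else_; not)
open import Data.List using (List; []; _∷_; _++_; length; take; allFin; map)
open import Data.Bool.ListAction using (and)
open import Data.List.Membership.Propositional using (_∈_)
open import Data.List.Relation.Unary.Any using (any?)
open import Data.Maybe using (Maybe; just; nothing)
import Data.Maybe as Maybe
open import Data.Product using (Σ; _×_; _,_; proj₁; proj₂)
open import Data.Sum using (_⊎_)
open import Relation.Nullary using (¬_; does)
open import Relation.Binary.PropositionalEquality using (_≡_)

-- The ring of size n: nodes v_0 … v_{n-1} (as Fin n), edge e joins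
-- v_e and v_{e+1 mod n}.  Port r leads to the successor, port ℓ to
-- the predecessor.

data Dir : Set where
  ℓ r : Dir

opp : Dir → Dir
opp ℓ = r
opp r = ℓ

next : ∀ {n} → Fin n → Fin n
next {suc m} i = fromℕ< (m%n<n (suc (toℕ i)) (suc m))

prev : ∀ {n} → Fin n → Fin n
prev {suc m} zero    = fromℕ m
prev {suc m} (suc i) = inject₁ i

edgeOf : ∀ {n} → Fin n → Dir → Fin n
edgeOf i r = i
edgeOf i ℓ = prev i

target : ∀ {n} → Fin n → Dir → Fin n
target i r = next i
target i ℓ = prev i

FaultConfig : ℕ → Set
FaultConfig n = Fin n → Bool

step : ∀ {n} → FaultConfig n → Fin n → Dir → Maybe (Fin n)
step F i d = if F (edgeOf i d) then nothing else just (target i d)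

trace : ∀ {n} → FaultConfig n → Fin n → List Dir → Maybe (List (Fin n))
trace F i [] = just (i ∷ [])
trace F i (d ∷ ds) with step F i d
... | nothing = nothing
... | just j  = Maybe.map (i ∷_) (trace F j ds)

-- u belongs to C, the component of v in the graph without faulty edges.
InC : ∀ {n} → FaultConfig n → Fin n → Fin n → Set
InC {n} F v u = Σ (List Dir) λ ds → Σ (List (Fin n)) λ ns → trace F v ds ≡ just ns × u ∈ ns

CSingleton : ∀ {n} → FaultConfig n → Fin n → Set
CSingleton F v = ∀ u → InC F v u → u ≡ v

Covers : ∀ {n} → FaultConfig n → Fin n → List Dir → Set
Covers {n} F v ds = Σ (List (Fin n)) λ ns → trace F v ds ≡ just ns × (∀ u → InC F v u → u ∈ ns)

IsOpt : ∀ {n} → FaultConfig n → Fin n → ℕ → Set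
IsOpt F v o = (Σ (List Dir) λ ds → length ds ≡ o × Covers F v ds)
            × (∀ ds → Covers F v ds → o ≤ length ds)

allVisited : ∀ {n} → List (Fin n) → Bool
allVisited {n} vis = and (map (λ u → does (any? (u ≟_) vis)) (allFin n))

-- Repeatedly take port d until port d at the current node is faulty or
-- all n nodes are visited (fuel only bounds recursion; it is never the
-- binding constraint when fuel ≥ 2n).
go : ∀ {n} → FaultConfig n → Dir → ℕ → Fin n → List (Fin n)
   → List Dir × Fin n × List (Fin n)
go F d zero i vis = [] , i , vis
go F d (suc k) i vis =
  if allVisited vis then ([] , i , vis)
  else if F (edgeOf i d) then ([] , i , vis)
  else (let res = go F d k (target i d) (target i d ∷ vis)
        in d ∷ proj₁ res , proj₂ res)

algMoves : ∀ {n} → FaultConfig n → Fin n → Dir → List Dir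
algMoves {n} F v d =
  let p1 = go F d (2 * n) v (v ∷ [])
      p2 = go F (opp d) (2 * n) (proj₁ (proj₂ p1)) (proj₂ (proj₂ p1))
  in proj₁ p1 ++ proj₁ p2

IsAlgCost : ∀ {n} → FaultConfig n → Fin n → Dir → ℕ → Set
IsAlgCost F v d c =
  c ≤ length (algMoves F v d)
  × Covers F v (take c (algMoves F v d))
  × (∀ j → j < c → ¬ Covers F v (take j (algMoves F v d)))

-- The ratio C(A,F)/opt(F) (defined as 1 when C = {v}) is ≥ num/den.
RatioAtLeast : ∀ {n} → FaultConfig n → Fin n → (c o num den : ℕ) → Set
RatioAtLeast F v c o num den =
  (CSingleton F v × num ≤ den) ⊎ (¬ CSingleton F v × num * o ≤ den * c)

module Submission where

open import Data.Bool using (true; false)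
open import Data.Bool.ListAction using (and)
open import Data.Empty using (⊥; ⊥-elim)
open import Data.Fin using (Fin; zero; suc; toℕ; fromℕ)
open import Data.Fin.Properties
  using (_≟_; toℕ-injective; toℕ≤pred[n]; toℕ-fromℕ; toℕ-fromℕ<; toℕ<n; toℕ-inject₁)
open import Data.List using (List; []; _∷_; _++_; length; take; replicate)
open import Data.List.Properties using (++-identityʳ; length-replicate; length-++; take-all)
open import Data.List.Membership.Propositional using (_∈_)
open import Data.List.Membership.Propositional.Properties using (∈-map⁺; ∈-allFin)
open import Data.List.Relation.Unary.Any using (here; there; any?)
open import Data.Maybe using (just; nothing)
import Data.Maybe as Maybe
open import Data.Maybe.Properties using (just-injective)
open import Data.Nat using (ℕ; zero; suc; _+_; _*_; _∸_; _≤_; _<_; z≤n; s≤s; s≤s⁻¹)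
open import Data.Nat.DivMod using (_%_; n%n≡0; m<n⇒m%n≡m)
open import Data.Nat.Properties hiding (_≟_)
open import Data.Product using (Σ; _×_; _,_; proj₁; proj₂)
open import Data.Sum using (_⊎_; inj₁; inj₂)
open import Relation.Binary.PropositionalEquality
open import Relation.Nullary using (¬_; does)
open import Relation.Nullary.Decidable using (dec-true; dec-false)

open import Defs

-- Write n = N + 1 and let s be the neighbour of v through port opp d.
-- Walking from s in direction d lists the ring as q 0 = s, q 1 = v, …, q N.
-- Making only the edge {q N, q 0} faulty turns the ring into the path
-- q 0 — q 1 — … — q N, the component of v.  The algorithm climbs from q 1
-- to the blocked end q N (N - 1 moves), then descends to q 0 (N moves), and
-- q 0 is reached only by its last move: cost 2N - 1 = 2n - 3.  The optimal
-- walk steps down to q 0 first and then climbs: N + 1 = n moves; no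
-- covering walk is shorter, since it must visit both ends of the path.

toℕ-next : ∀ {N} (i : Fin (suc N)) →
           (toℕ i ≡ N × next i ≡ zero) ⊎ toℕ (next i) ≡ suc (toℕ i)
toℕ-next {N} i with m≤n⇒m<n∨m≡n (toℕ≤pred[n] i)
... | inj₁ i<N = inj₂ (trans (toℕ-fromℕ< _) (m<n⇒m%n≡m (s≤s i<N)))
... | inj₂ i≡N = inj₁ (i≡N , toℕ-injective (begin
      toℕ (next i)          ≡⟨ toℕ-fromℕ< _ ⟩
      suc (toℕ i) % suc N   ≡⟨ cong (λ x → suc x % suc N) i≡N ⟩
      suc N % suc N         ≡⟨ n%n≡0 (suc N) ⟩
      0                     ∎))
  where open ≡-Reasoning

toℕ-prev : ∀ {N} (i : Fin (suc N)) →
           (i ≡ zero × prev i ≡ fromℕ N) ⊎ suc (toℕ (prev i)) ≡ toℕ i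
toℕ-prev zero    = inj₁ (refl , refl)
toℕ-prev (suc i) = inj₂ (cong suc (toℕ-inject₁ i))

index≢1+N : ∀ {N} (i : Fin (suc N)) → toℕ i ≢ suc N
index≢1+N {N} i eq = <-irrefl refl (subst (_< suc N) eq (toℕ<n i))

prev-next : ∀ {N} (i : Fin (suc N)) → prev (next i) ≡ i
prev-next {N} i with toℕ-next i
... | inj₁ (i≡N , next≡0) rewrite next≡0 = toℕ-injective (trans (toℕ-fromℕ N) (sym i≡N))
... | inj₂ next≡1+i with toℕ-prev (next i)
...   | inj₁ (next≡0 , _) = ⊥-elim (0≢1+n (trans (cong toℕ (sym next≡0)) next≡1+i))
...   | inj₂ 1+prev≡next  = toℕ-injective (suc-injective (trans 1+prev≡next next≡1+i))

next-prev : ∀ {N} (i : Fin (suc N)) → next (prev i) ≡ i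
next-prev {N} i with toℕ-prev i
... | inj₁ (refl , prev≡N) rewrite prev≡N with toℕ-next (fromℕ N)
...   | inj₁ (_ , next≡0) = next≡0
...   | inj₂ next≡1+N     =
        ⊥-elim (index≢1+N (next (fromℕ N)) (trans next≡1+N (cong suc (toℕ-fromℕ N))))
next-prev {N} i | inj₂ 1+prev≡i with toℕ-next (prev i)
...   | inj₁ (prev≡N , _) = ⊥-elim (index≢1+N i (trans (sym 1+prev≡i) (cong suc prev≡N)))
...   | inj₂ next≡1+prev  = toℕ-injective (trans next≡1+prev 1+prev≡i)

back-and-forth : ∀ {N} d (i : Fin (suc N)) → target (target i d) (opp d) ≡ i
back-and-forth r = prev-next
back-and-forth ℓ = next-prev

forth-and-back : ∀ {N} d (i : Fin (suc N)) → target (target i (opp d)) d ≡ i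
forth-and-back r = back-and-forth ℓ
forth-and-back ℓ = back-and-forth r

edge-back : ∀ {N} d (i : Fin (suc N)) → edgeOf (target i d) (opp d) ≡ edgeOf i d
edge-back r i = prev-next i
edge-back ℓ i = refl

edgeOf-injective : ∀ {N} d {i j : Fin (suc N)} → edgeOf i d ≡ edgeOf j d → i ≡ j
edgeOf-injective r e = e
edgeOf-injective ℓ {i} {j} e = begin
  i               ≡⟨ sym (next-prev i) ⟩
  next (prev i)   ≡⟨ cong next e ⟩
  next (prev j)   ≡⟨ next-prev j ⟩
  j               ∎
  where open ≡-Reasoning

walk : ∀ {N} → Dir → Fin (suc N) → ℕ → Fin (suc N)
walk d s zero    = s
walk d s (suc k) = target (walk d s k) d

walk-shift : ∀ {N} d (s : Fin (suc N)) k → walk d s (suc k) ≡ walk d (target s d) k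
walk-shift d s zero    = refl
walk-shift d s (suc k) = cong (λ t → target t d) (walk-shift d s k)

walk-undo : ∀ {N} d (s : Fin (suc N)) k → walk (opp d) (walk d s k) k ≡ s
walk-undo d s zero    = refl
walk-undo d s (suc k) = begin
  walk (opp d) (target (walk d s k) d) (suc k)               ≡⟨ walk-shift (opp d) _ k ⟩
  walk (opp d) (target (target (walk d s k) d) (opp d)) k    ≡⟨ cong (λ t → walk (opp d) t k) (back-and-forth d _) ⟩
  walk (opp d) (walk d s k) k                                ≡⟨ walk-undo d s k ⟩
  s                                                          ∎
  where open ≡-Reasoning

no-overflow : ∀ {N x y} → x ≤ N → x ≡ y + suc N → ⊥
no-overflow {N} {x} {y} x≤N x≡y+1+N = <-irrefl refl (begin-strict
  suc N       ≤⟨ m≤n+m (suc N) y ⟩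
  y + suc N   ≡⟨ sym x≡y+1+N ⟩
  x           ≤⟨ x≤N ⟩
  N           <⟨ n<1+n N ⟩
  suc N       ∎)
  where open ≤-Reasoning

walk-r-index : ∀ {N} (s : Fin (suc N)) k → k ≤ suc N →
  toℕ (walk r s k) ≡ toℕ s + k ⊎ toℕ (walk r s k) + suc N ≡ toℕ s + k
walk-r-index s zero _ = inj₁ (sym (+-identityʳ _))
walk-r-index {N} s (suc k) (s≤s k≤N)
  with walk-r-index s k (m≤n⇒m≤1+n k≤N) | toℕ-next (walk r s k)
... | inj₁ t≡s+k  | inj₂ next≡1+t = inj₁ (begin
      toℕ (next (walk r s k))   ≡⟨ next≡1+t ⟩
      suc (toℕ (walk r s k))    ≡⟨ cong suc t≡s+k ⟩
      suc (toℕ s + k)           ≡⟨ sym (+-suc (toℕ s) k) ⟩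
      toℕ s + suc k             ∎)
  where open ≡-Reasoning
... | inj₁ t≡s+k  | inj₁ (t≡N , next≡0) rewrite next≡0 = inj₂ (begin
      suc N                     ≡⟨ cong suc (sym t≡N) ⟩
      suc (toℕ (walk r s k))    ≡⟨ cong suc t≡s+k ⟩
      suc (toℕ s + k)           ≡⟨ sym (+-suc (toℕ s) k) ⟩
      toℕ s + suc k             ∎)
  where open ≡-Reasoning
... | inj₂ t+n≡s+k | inj₂ next≡1+t = inj₂ (begin
      toℕ (next (walk r s k)) + suc N   ≡⟨ cong (_+ suc N) next≡1+t ⟩
      suc (toℕ (walk r s k) + suc N)    ≡⟨ cong suc t+n≡s+k ⟩
      suc (toℕ s + k)                   ≡⟨ sym (+-suc (toℕ s) k) ⟩
      toℕ s + suc k                     ∎)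
  where open ≡-Reasoning
... | inj₂ t+n≡s+k | inj₁ (t≡N , _) = ⊥-elim (<-irrefl refl (begin-strict
      N + suc N                       ≡⟨ cong (_+ suc N) (sym t≡N) ⟩
      toℕ (walk r s k) + suc N        ≡⟨ t+n≡s+k ⟩
      toℕ s + k                       ≤⟨ +-mono-≤ (toℕ≤pred[n] s) k≤N ⟩
      N + N                           <⟨ +-monoʳ-< N (n<1+n N) ⟩
      N + suc N                       ∎))
  where open ≤-Reasoning

wrap-mismatch : ∀ {N} (s : Fin (suc N)) {k k'} → k' ≤ N → walk r s k ≡ walk r s k' →
                toℕ (walk r s k) ≡ toℕ s + k → toℕ (walk r s k') + suc N ≡ toℕ s + k' → ⊥
wrap-mismatch {N} s {k} {k'} k'≤N e p p' = no-overflow k'≤N (+-cancelˡ-≡ (toℕ s) _ _ (begin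
  toℕ s + k'                      ≡⟨ sym p' ⟩
  toℕ (walk r s k') + suc N       ≡⟨ cong (λ t → toℕ t + suc N) (sym e) ⟩
  toℕ (walk r s k) + suc N        ≡⟨ cong (_+ suc N) p ⟩
  toℕ s + k + suc N               ≡⟨ +-assoc (toℕ s) k (suc N) ⟩
  toℕ s + (k + suc N)             ∎))
  where open ≡-Reasoning

walk-r-injective : ∀ {N} (s : Fin (suc N)) {k k'} → k ≤ N → k' ≤ N →
                   walk r s k ≡ walk r s k' → k ≡ k'
walk-r-injective {N} s {k} {k'} k≤N k'≤N e
  with walk-r-index s k (m≤n⇒m≤1+n k≤N) | walk-r-index s k' (m≤n⇒m≤1+n k'≤N)
... | inj₁ p | inj₁ p' = +-cancelˡ-≡ (toℕ s) k k' (trans (sym p) (trans (cong toℕ e) p'))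
... | inj₂ p | inj₂ p' = +-cancelˡ-≡ (toℕ s) k k' (trans (sym p) (trans (cong (λ t → toℕ t + suc N) e) p'))
... | inj₁ p | inj₂ p' = ⊥-elim (wrap-mismatch s k'≤N e p p')
... | inj₂ p | inj₁ p' = ⊥-elim (wrap-mismatch s k≤N (sym e) p' p)

walk-r-closes : ∀ {N} (s : Fin (suc N)) → walk r s (suc N) ≡ s
walk-r-closes {N} s with walk-r-index s (suc N) ≤-refl
... | inj₁ p = ⊥-elim (no-overflow (toℕ≤pred[n] (walk r s (suc N))) p)
... | inj₂ p = toℕ-injective (+-cancelʳ-≡ _ _ _ p)

-- The first N+1 nodes of a walk are pairwise distinct (in direction ℓ
-- this follows from direction r, since walking ℓ is undone by walking r).
walk-injective : ∀ {N} d (s : Fin (suc N)) {k k'} → k ≤ N → k' ≤ N →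
                 walk d s k ≡ walk d s k' → k ≡ k'
walk-injective r s = walk-r-injective s
walk-injective ℓ s {k} {k'} k≤N k'≤N e = walk-r-injective (walk ℓ s k) k≤N k'≤N (begin
  walk r (walk ℓ s k) k     ≡⟨ walk-undo ℓ s k ⟩
  s                         ≡⟨ sym (walk-undo ℓ s k') ⟩
  walk r (walk ℓ s k') k'   ≡⟨ cong (λ t → walk r t k') (sym e) ⟩
  walk r (walk ℓ s k) k'    ∎)
  where open ≡-Reasoning

walk-closes : ∀ {N} d (s : Fin (suc N)) → walk d s (suc N) ≡ s
walk-closes r s = walk-r-closes s
walk-closes {N} ℓ s = begin
  walk ℓ s (suc N)                           ≡⟨ sym (walk-r-closes _) ⟩
  walk r (walk ℓ s (suc N)) (suc N)          ≡⟨ walk-undo ℓ s (suc N) ⟩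
  s                                          ∎
  where open ≡-Reasoning

same-or-opp : ∀ d x → x ≡ d ⊎ x ≡ opp d
same-or-opp ℓ ℓ = inj₁ refl
same-or-opp ℓ r = inj₂ refl
same-or-opp r ℓ = inj₂ refl
same-or-opp r r = inj₁ refl

trace-step : ∀ {n} (F : FaultConfig n) {i j} x ds → step F i x ≡ just j →
             trace F i (x ∷ ds) ≡ Maybe.map (i ∷_) (trace F j ds)
trace-step F x ds eq rewrite eq = refl

trace-inversion : ∀ {n} (F : FaultConfig n) i x ds {ns} → trace F i (x ∷ ds) ≡ just ns →
  Σ (Fin n) λ j → step F i x ≡ just j ×
  Σ (List (Fin n)) λ ns' → trace F j ds ≡ just ns' × ns ≡ i ∷ ns'
trace-inversion F i x ds t with step F i x
... | nothing with () ← t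
... | just j with trace F j ds in eq'
...   | nothing with () ← t
...   | just ns' with refl ← t = j , refl , ns' , eq' , refl

and-false : ∀ {bs} → false ∈ bs → and bs ≡ false
and-false {false ∷ _}  _         = refl
and-false {true  ∷ _}  (there m) = and-false m

allVisited-missing : ∀ {n} (vis : List (Fin n)) {u} → ¬ u ∈ vis → allVisited vis ≡ false
allVisited-missing {n} vis {u} u∉vis =
  and-false (subst (_∈ _) (dec-false (any? (u ≟_) vis) u∉vis)
                   (∈-map⁺ (λ w → does (any? (w ≟_) vis)) (∈-allFin u)))

go-blocked : ∀ {n} (F : FaultConfig n) d f i vis → allVisited vis ≡ false → F (edgeOf i d) ≡ true →
             go F d (suc f) i vis ≡ ([] , i , vis)
go-blocked F d f i vis notDone faulty rewrite notDone | faulty = refl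

go-move : ∀ {n} (F : FaultConfig n) d f i vis → allVisited vis ≡ false → F (edgeOf i d) ≡ false →
          go F d (suc f) i vis ≡
            (d ∷ proj₁ (go F d f (target i d) (target i d ∷ vis)) ,
             proj₂ (go F d f (target i d) (target i d ∷ vis)))
go-move F d f i vis notDone free rewrite notDone | free = refl

LowerBoundAt : (n : ℕ) → Fin n → Dir → Set
LowerBoundAt n v d = Σ (FaultConfig n) λ F → Σ ℕ λ c → Σ ℕ λ o →
  IsAlgCost F v d c × IsOpt F v o × RatioAtLeast F v c o (2 * n ∸ 3) n

double-minus-three : ∀ N → 1 ≤ N → 2 * suc N ∸ 3 ≡ (N ∸ 1) + N
double-minus-three (suc M) _ = begin
  M + suc (suc (M + 0)) ∸ 1   ≡⟨ cong (_∸ 1) (+-suc M _) ⟩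
  M + suc (M + 0)             ≡⟨ cong (λ x → M + suc x) (+-identityʳ M) ⟩
  M + suc M                   ∎
  where open ≡-Reasoning

-- The fault configuration of the lower bound: a single faulty edge turns
-- the ring into the path q 0, q 1, …, q N (walking from s in direction d).
module Path {N : ℕ} (d : Dir) (s : Fin (suc N)) where

  q : ℕ → Fin (suc N)
  q = walk d s

  q-injective : ∀ {j k} → j ≤ N → k ≤ N → q j ≡ q k → j ≡ k
  q-injective = walk-injective d s

  faultyEdge : Fin (suc N)
  faultyEdge = edgeOf (q N) d

  F : FaultConfig (suc N)
  F e = does (e ≟ faultyEdge)

  faultyEdge-faulty : F faultyEdge ≡ true
  faultyEdge-faulty = dec-true (faultyEdge ≟ faultyEdge) refl

  path-edge-free : ∀ {k} → k < N → F (edgeOf (q k) d) ≡ false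
  path-edge-free {k} k<N = dec-false (edgeOf (q k) d ≟ faultyEdge)
    (λ e → <-irrefl (q-injective (<⇒≤ k<N) ≤-refl (edgeOf-injective d e)) k<N)

  faultyEdge-at-0 : edgeOf (q 0) (opp d) ≡ faultyEdge
  faultyEdge-at-0 = begin
    edgeOf s (opp d)                   ≡⟨ cong (λ t → edgeOf t (opp d)) (sym (walk-closes d s)) ⟩
    edgeOf (target (q N) d) (opp d)    ≡⟨ edge-back d (q N) ⟩
    faultyEdge                         ∎
    where open ≡-Reasoning

  step-up : ∀ {k} → k < N → step F (q k) d ≡ just (q (suc k))
  step-up k<N rewrite path-edge-free k<N = refl

  step-up-blocked : step F (q N) d ≡ nothing
  step-up-blocked rewrite faultyEdge-faulty = refl

  step-down : ∀ {j} → suc j ≤ N → step F (q (suc j)) (opp d) ≡ just (q j)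
  step-down {j} j<N rewrite edge-back d (q j) | path-edge-free j<N | back-and-forth d (q j) = refl

  step-down-blocked : step F (q 0) (opp d) ≡ nothing
  step-down-blocked rewrite faultyEdge-at-0 | faultyEdge-faulty = refl

  PathTrace : ℕ → List Dir → List (Fin (suc N)) → Set
  PathTrace k ds ns = trace F (q k) ds ≡ just ns

  trace-up : ∀ {k ds ns} → k ≤ N → PathTrace k (d ∷ ds) ns →
    k < N × Σ (List (Fin (suc N))) λ ns' → PathTrace (suc k) ds ns' × ns ≡ q k ∷ ns'
  trace-up {k} {ds} k≤N t with trace-inversion F (q k) d ds t | m≤n⇒m<n∨m≡n k≤N
  ... | _ , st , _ | inj₂ refl with () ← trans (sym step-up-blocked) st
  ... | _ , st , ns' , t' , refl | inj₁ k<N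
        with refl ← just-injective (trans (sym (step-up k<N)) st) = k<N , ns' , t' , refl

  trace-down : ∀ {k ds ns} → k ≤ N → PathTrace k (opp d ∷ ds) ns →
    Σ ℕ λ j → k ≡ suc j × Σ (List (Fin (suc N))) λ ns' → PathTrace j ds ns' × ns ≡ q k ∷ ns'
  trace-down {zero} {ds} _ t with trace-inversion F (q 0) (opp d) ds t
  ... | _ , st , _ with () ← trans (sym step-down-blocked) st
  trace-down {suc j} {ds} k≤N t with trace-inversion F (q (suc j)) (opp d) ds t
  ... | _ , st , ns' , t' , refl
        with refl ← just-injective (trans (sym (step-down k≤N)) st) = j , refl , ns' , t' , refl

  Near : ℕ → ℕ → Set
  Near k k' = k ≤ suc k' × k' ≤ suc k

  trace-any : ∀ {k} x ds {ns} → k ≤ N → PathTrace k (x ∷ ds) ns →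
    Σ ℕ λ k' → k' ≤ N × Near k k' ×
    Σ (List (Fin (suc N))) λ ns' → PathTrace k' ds ns' × ns ≡ q k ∷ ns'
  trace-any {k} x ds k≤N t with same-or-opp d x
  ... | inj₁ refl with trace-up k≤N t
  ...   | k<N , ns' , t' , ns≡ = suc k , k<N , (≤-trans (n≤1+n k) (n≤1+n (suc k)) , ≤-refl) , ns' , t' , ns≡
  trace-any {k} x ds k≤N t | inj₂ refl with trace-down k≤N t
  ...   | j , refl , ns' , t' , ns≡ =
          j , ≤-trans (n≤1+n j) k≤N , (≤-refl , ≤-trans (n≤1+n j) (n≤1+n (suc j))) , ns' , t' , ns≡

  trace-on-path : ∀ {k} ds {ns} → k ≤ N → PathTrace k ds ns → ∀ {u} → u ∈ ns →
                  Σ ℕ λ j → j ≤ N × u ≡ q j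
  trace-on-path {k} [] k≤N refl (here u≡qk) = k , k≤N , u≡qk
  trace-on-path {k} (x ∷ ds) k≤N t u∈ns with trace-any x ds k≤N t
  ... | k' , k'≤N , _ , ns' , t' , refl with u∈ns
  ...   | here u≡qk = k , k≤N , u≡qk
  ...   | there u∈ns' = trace-on-path ds k'≤N t' u∈ns'

  ∈-q-cons : ∀ {j k ns} → j ≤ N → k ≤ N → q j ∈ (q k ∷ ns) → j ≡ k ⊎ q j ∈ ns
  ∈-q-cons j≤N k≤N (here e)  = inj₁ (q-injective j≤N k≤N e)
  ∈-q-cons j≤N k≤N (there m) = inj₂ m

  distance-bound : ∀ {k j} ds {ns} → k ≤ N → j ≤ N → PathTrace k ds ns → q j ∈ ns →
                   k ≤ j + length ds × j ≤ k + length ds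
  distance-bound {k} {j} [] k≤N j≤N refl (here e) rewrite q-injective j≤N k≤N e =
    m≤m+n k 0 , m≤m+n k 0
  distance-bound {k} {j} (x ∷ ds) k≤N j≤N t m with trace-any x ds k≤N t
  ... | k' , k'≤N , (k≤1+k' , k'≤1+k) , ns' , t' , refl with ∈-q-cons j≤N k≤N m
  ...   | inj₁ refl = m≤m+n k _ , m≤m+n k _
  ...   | inj₂ m' with distance-bound ds k'≤N j≤N t' m'
  ...     | k'≤j+len , j≤k'+len = (begin
            k                      ≤⟨ k≤1+k' ⟩
            suc k'                 ≤⟨ s≤s k'≤j+len ⟩
            suc (j + length ds)    ≡⟨ sym (+-suc j _) ⟩
            j + suc (length ds)    ∎) , (begin
            j                      ≤⟨ j≤k'+len ⟩
            k' + length ds         ≤⟨ +-monoˡ-≤ _ k'≤1+k ⟩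
            suc k + length ds      ≡⟨ sym (+-suc k _) ⟩
            k + suc (length ds)    ∎)
    where open ≤-Reasoning

  ends-bound : ∀ {k} ds {ns} → k ≤ N → PathTrace k ds ns → q 0 ∈ ns → q N ∈ ns →
               N + k ≤ length ds ⊎ N + N ≤ k + length ds
  ends-bound {k} [] k≤N refl (here e0) (here eN)
    with refl ← q-injective z≤n k≤N e0 = inj₁ (≤-reflexive (trans (+-identityʳ N) (q-injective ≤-refl z≤n eN)))
  ends-bound {k} (x ∷ ds) k≤N t m0 mN with trace-any x ds k≤N t
  ... | k' , k'≤N , (k≤1+k' , k'≤1+k) , ns' , t' , refl
      with ∈-q-cons z≤n k≤N m0 | ∈-q-cons ≤-refl k≤N mN
  ... | inj₁ refl | inj₁ N≡0 = inj₁ (≤-trans (≤-reflexive (trans (+-identityʳ N) N≡0)) z≤n)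
  ... | inj₁ refl | inj₂ mN' = inj₁ (begin
        N + 0                  ≡⟨ +-identityʳ N ⟩
        N                      ≤⟨ proj₂ (distance-bound ds k'≤N ≤-refl t' mN') ⟩
        k' + length ds         ≤⟨ +-monoˡ-≤ (length ds) k'≤1+k ⟩
        suc (length ds)        ∎)
    where open ≤-Reasoning
  ... | inj₂ m0' | inj₁ refl = inj₂ (+-monoʳ-≤ N (begin
        N                      ≤⟨ k≤1+k' ⟩
        suc k'                 ≤⟨ s≤s (proj₁ (distance-bound ds k'≤N z≤n t' m0')) ⟩
        suc (length ds)        ∎))
    where open ≤-Reasoning
  ... | inj₂ m0' | inj₂ mN' with ends-bound ds k'≤N t' m0' mN'
  ...   | inj₁ bottom-first = inj₁ (begin
          N + k                ≤⟨ +-monoʳ-≤ N k≤1+k' ⟩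
          N + suc k'           ≡⟨ +-suc N k' ⟩
          suc (N + k')         ≤⟨ s≤s bottom-first ⟩
          suc (length ds)      ∎)
    where open ≤-Reasoning
  ...   | inj₂ top-first = inj₂ (begin
          N + N                ≤⟨ top-first ⟩
          k' + length ds       ≤⟨ +-monoˡ-≤ (length ds) k'≤1+k ⟩
          suc k + length ds    ≡⟨ sym (+-suc k _) ⟩
          k + suc (length ds)  ∎)
    where open ≤-Reasoning

  run-up : ∀ a {k} ys {ns'} → a + k ≤ N → PathTrace (a + k) ys ns' →
    Σ (List (Fin (suc N))) λ ns → PathTrace k (replicate a d ++ ys) ns ×
    (∀ {j} → k ≤ j → j < a + k → q j ∈ ns) × (∀ {u} → u ∈ ns' → u ∈ ns)
  run-up zero ys _ t = _ , t , (λ k≤j j<k → ⊥-elim (<-irrefl refl (≤-trans j<k k≤j))) , λ m → m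
  run-up (suc a) {k} ys {ns'} a+k<N t
    with run-up a {suc k} ys (subst (_≤ N) (sym (+-suc a k)) a+k<N)
                             (subst (λ m → PathTrace m ys ns') (sym (+-suc a k)) t)
  ... | ns , t' , visited , ⊇ns' =
        q k ∷ ns , trans (trace-step F d _ (step-up k<N)) (cong (Maybe.map (q k ∷_)) t') ,
        visited' , (λ m → there (⊇ns' m))
    where
    k<N : k < N
    k<N = ≤-trans (s≤s (m≤n+m k a)) a+k<N
    visited' : ∀ {j} → k ≤ j → j < suc (a + k) → q j ∈ (q k ∷ ns)
    visited' {j} k≤j j<1+a+k with m≤n⇒m<n∨m≡n k≤j
    ... | inj₂ refl = here refl
    ... | inj₁ k<j  = there (visited k<j (subst (j <_) (sym (+-suc a k)) j<1+a+k))

  run-down : ∀ m → m ≤ N → Σ (List (Fin (suc N))) λ ns →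
             PathTrace m (replicate m (opp d)) ns × (∀ {j} → j ≤ m → q j ∈ ns)
  run-down zero _ = q 0 ∷ [] , refl , λ { z≤n → here refl }
  run-down (suc m) m<N with run-down m (<⇒≤ m<N)
  ... | ns , t , visited =
        q (suc m) ∷ ns , trans (trace-step F (opp d) _ (step-down m<N)) (cong (Maybe.map (q (suc m) ∷_)) t) ,
        visited'
    where
    visited' : ∀ {j} → j ≤ suc m → q j ∈ (q (suc m) ∷ ns)
    visited' {j} j≤1+m with m≤n⇒m<n∨m≡n j≤1+m
    ... | inj₂ refl     = here refl
    ... | inj₁ (s≤s j≤m) = there (visited j≤m)

  -- Everything reachable from a path node lies on the path, so a walk
  -- visiting every path node covers the component.
  covers-path : ∀ {k} ds {ns} → k ≤ N → PathTrace k ds ns →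
                (∀ {j} → j ≤ N → q j ∈ ns) → Covers F (q k) ds
  covers-path {k} ds {ns} k≤N t visited = ns , t , covered
    where
    covered : ∀ u → InC F (q k) u → u ∈ ns
    covered u (ds' , ns' , t' , u∈ns') with trace-on-path ds' k≤N t' u∈ns'
    ... | j , j≤N , refl = visited j≤N

  -- The optimal exploration from q 1: one step down to q 0, then up
  -- through the whole path.
  sweep : List Dir
  sweep = opp d ∷ replicate N d

  sweep-trace : 1 ≤ N → Σ (List (Fin (suc N))) λ ns →
                PathTrace 1 sweep ns × (∀ {j} → j ≤ N → q j ∈ ns)
  sweep-trace 1≤N with run-up N {0} [] (≤-reflexive (+-identityʳ N)) refl
  ... | ns , t , visited , ⊇end = q 1 ∷ ns ,
        trans (trace-step F (opp d) _ (step-down 1≤N))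
              (cong (Maybe.map (q 1 ∷_)) (subst (λ ms → PathTrace 0 ms ns) (++-identityʳ (replicate N d)) t)) ,
        λ j≤N → there (visited' j≤N)
    where
    visited' : ∀ {j} → j ≤ N → q j ∈ ns
    visited' {j} j≤N with m≤n⇒m<n∨m≡n j≤N
    ... | inj₁ j<N = visited z≤n (subst (j <_) (sym (+-identityʳ N)) j<N)
    ... | inj₂ refl = ⊇end (here (cong q (sym (+-identityʳ N))))

  path-in-component : 1 ≤ N → ∀ {j} → j ≤ N → InC F (q 1) (q j)
  path-in-component 1≤N j≤N with sweep-trace 1≤N
  ... | ns , t , visited = sweep , ns , t , visited j≤N

  -- opt(F) = N + 1 from q 1: a covering walk visits both ends, which by
  -- ends-bound costs at least min (N + 1, 2N - 1) = N + 1 steps.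
  sweep-optimal : 2 ≤ N → IsOpt F (q 1) (suc N)
  sweep-optimal 2≤N with sweep-trace (<⇒≤ 2≤N)
  ... | ns , t , visited = (sweep , cong suc (length-replicate N) , covers-path sweep 1≤N t visited) ,
                           lower-bound
    where
    1≤N : 1 ≤ N
    1≤N = <⇒≤ 2≤N
    lower-bound : ∀ ds → Covers F (q 1) ds → suc N ≤ length ds
    lower-bound ds (ns , t , covered)
      with ends-bound ds 1≤N t (covered _ (path-in-component 1≤N z≤n))
                               (covered _ (path-in-component 1≤N ≤-refl))
    ... | inj₁ N+1≤len = subst (_≤ length ds) (+-comm N 1) N+1≤len
    ... | inj₂ 2N≤1+len = s≤s⁻¹ (≤-trans (+-monoˡ-≤ N 2≤N) 2N≤1+len)

  bottom-not-first : ∀ {k ns} → 1 ≤ k → k ≤ N → q 0 ∈ (q k ∷ ns) → q 0 ∈ ns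
  bottom-not-first 1≤k k≤N m with ∈-q-cons z≤n k≤N m
  ... | inj₁ 0≡k = ⊥-elim (<-irrefl 0≡k 1≤k)
  ... | inj₂ m'  = m'

  start-misses-bottom : 1 ≤ N → ¬ q 0 ∈ (q 1 ∷ [])
  start-misses-bottom 1≤N m with () ← bottom-not-first ≤-refl 1≤N m

  prefix-misses-bottom : ∀ a b {k} j {ns} → 1 ≤ k → a + k ≤ N → b ≤ a + k → j < a + b →
    PathTrace k (take j (replicate a d ++ replicate b (opp d))) ns → ¬ q 0 ∈ ns
  prefix-misses-bottom a b {k} zero 1≤k a+k≤N _ _ refl m
    with () ← bottom-not-first 1≤k (≤-trans (m≤n+m k a) a+k≤N) m
  prefix-misses-bottom (suc a) b {k} (suc j) 1≤k a+k<N b≤ (s≤s j<) t m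
    with trace-up (≤-trans (m≤n+m k (suc a)) a+k<N) t
  ... | _ , ns' , t' , refl =
        prefix-misses-bottom a b {suc k} j (s≤s z≤n)
          (subst (_≤ N) (sym (+-suc a k)) a+k<N) (subst (b ≤_) (sym (+-suc a k)) b≤) j< t'
          (bottom-not-first 1≤k (≤-trans (m≤n+m k (suc a)) a+k<N) m)
  prefix-misses-bottom zero (suc b) {k} (suc j) 1≤k k≤N b<k (s≤s j<b) t m
    with trace-down k≤N t
  ... | k' , refl , ns' , t' , refl =
        prefix-misses-bottom zero b {k'} j (≤-trans (s≤s z≤n) (≤-trans j<b (s≤s⁻¹ b<k)))
          (<⇒≤ k≤N) (s≤s⁻¹ b<k) j<b t' (bottom-not-first 1≤k k≤N m)

  below-top : ∀ a k → suc a + k ≡ N → k < N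
  below-top a k a+k≡N = subst (k <_) a+k≡N (s≤s (m≤n+m k a))

  first-phase : ∀ a {k} f vis → a + k ≡ N → a ≤ f → ¬ q 0 ∈ vis →
    proj₁ (go F d f (q k) vis) ≡ replicate a d ×
    proj₁ (proj₂ (go F d f (q k) vis)) ≡ q N ×
    ¬ q 0 ∈ proj₂ (proj₂ (go F d f (q k) vis))
  first-phase zero zero vis refl _ 0∉vis = refl , refl , 0∉vis
  first-phase zero (suc f) vis refl _ 0∉vis
    rewrite go-blocked F d f (q N) vis (allVisited-missing vis 0∉vis) faultyEdge-faulty =
    refl , refl , 0∉vis
  first-phase (suc a) {k} (suc f) vis a+k≡N (s≤s a≤f) 0∉vis
    rewrite go-move F d f (q k) vis (allVisited-missing vis 0∉vis) (path-edge-free (below-top a k a+k≡N))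
    with first-phase a {suc k} f (q (suc k) ∷ vis) (trans (+-suc a k) a+k≡N) a≤f
           (λ m → 0∉vis (bottom-not-first (s≤s z≤n) (below-top a k a+k≡N) m))
  ... | moves≡ , end≡ , 0∉vis' = cong (d ∷_) moves≡ , end≡ , 0∉vis'

  -- Phase 2 from q k: it walks down the k steps to the faulty edge at q 0;
  -- it does not stop early because q 0 is still unvisited.
  second-phase : ∀ k f vis → k ≤ N → k ≤ f → (0 < k → ¬ q 0 ∈ vis) →
    proj₁ (go F (opp d) f (q k) vis) ≡ replicate k (opp d)
  second-phase zero zero vis _ _ _ = refl
  second-phase zero (suc f) vis _ _ _ with allVisited vis
  ... | true  = refl
  ... | false rewrite faultyEdge-at-0 | faultyEdge-faulty = refl
  second-phase (suc k) (suc f) vis k<N (s≤s k≤f) 0∉vis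
    rewrite go-move F (opp d) f (q (suc k)) vis (allVisited-missing vis (0∉vis (s≤s z≤n)))
              (trans (cong F (edge-back d (q k))) (path-edge-free k<N))
          | back-and-forth d (q k)
    = cong (opp d ∷_) (second-phase k f (q k ∷ vis) (<⇒≤ k<N) k≤f 0∉vis')
    where
    0∉vis' : 0 < k → ¬ q 0 ∈ (q k ∷ vis)
    0∉vis' 0<k m = 0∉vis (s≤s z≤n) (bottom-not-first 0<k (<⇒≤ k<N) m)

  -- The algorithm's fuel 2(N + 1) never runs out on the path.
  N≤fuel : N ≤ 2 * suc N
  N≤fuel = ≤-trans (n≤1+n N) (m≤m+n (suc N) _)

  up-down : List Dir
  up-down = replicate (N ∸ 1) d ++ replicate N (opp d)

  -- Phase 1 climbs N - 1 steps to q N, keeping q 0 unvisited, so phase 2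
  -- descends all N steps to q 0.
  algorithm-moves : 1 ≤ N → algMoves F (q 1) d ≡ up-down
  algorithm-moves 1≤N
    with first-phase (N ∸ 1) {1} (2 * suc N) (q 1 ∷ []) (m∸n+n≡m 1≤N)
                     (≤-trans (m∸n≤m N 1) N≤fuel) (start-misses-bottom 1≤N)
  ... | moves≡ , end≡ , 0∉vis = cong₂ _++_ moves≡ (begin
        proj₁ (go F (opp d) (2 * suc N) _ vis)     ≡⟨ cong (λ i → proj₁ (go F (opp d) (2 * suc N) i vis)) end≡ ⟩
        proj₁ (go F (opp d) (2 * suc N) (q N) vis) ≡⟨ second-phase N (2 * suc N) vis ≤-refl N≤fuel (λ _ → 0∉vis) ⟩
        replicate N (opp d)                        ∎)
    where
    open ≡-Reasoning
    vis : List (Fin (suc N))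
    vis = proj₂ (proj₂ (go F d (2 * suc N) (q 1) (q 1 ∷ [])))

  up-down-length : length up-down ≡ (N ∸ 1) + N
  up-down-length = begin
    length (replicate (N ∸ 1) d ++ replicate N (opp d))           ≡⟨ length-++ (replicate (N ∸ 1) d) ⟩
    length (replicate (N ∸ 1) d) + length (replicate N (opp d))   ≡⟨ cong₂ _+_ (length-replicate (N ∸ 1)) (length-replicate N) ⟩
    (N ∸ 1) + N                                                   ∎
    where open ≡-Reasoning

  -- The up-down walk succeeds and covers the component (it sweeps the
  -- whole path on its way down) …
  up-down-covers : 1 ≤ N → Covers F (q 1) up-down
  up-down-covers 1≤N with run-down N ≤-refl
  ... | ns' , t' , visited' with run-up (N ∸ 1) {1} (replicate N (opp d)) (≤-reflexive (m∸n+n≡m 1≤N))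
                                  (subst (λ m → PathTrace m (replicate N (opp d)) ns') (sym (m∸n+n≡m 1≤N)) t')
  ... | ns , t , _ , ⊇ns' = covers-path up-down 1≤N t (λ j≤N → ⊇ns' (visited' j≤N))

  -- … but no proper prefix does, since q 0 is reached only by the last move.
  up-down-prefixes : 1 ≤ N → ∀ j → j < (N ∸ 1) + N → ¬ Covers F (q 1) (take j up-down)
  up-down-prefixes 1≤N j j<c (ns , t , covered) =
    prefix-misses-bottom (N ∸ 1) N j ≤-refl (≤-reflexive (m∸n+n≡m 1≤N)) (≤-reflexive (sym (m∸n+n≡m 1≤N)))
                         j<c t (covered (q 0) (path-in-component 1≤N z≤n))

  algorithm-cost : 1 ≤ N → IsAlgCost F (q 1) d ((N ∸ 1) + N)
  algorithm-cost 1≤N rewrite algorithm-moves 1≤N =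
    ≤-reflexive (sym up-down-length) ,
    subst (Covers F (q 1)) (sym (take-all _ up-down (≤-reflexive up-down-length))) (up-down-covers 1≤N) ,
    up-down-prefixes 1≤N

  -- The fault configuration witnesses the bound at q 1: the algorithm pays
  -- 2N - 1 = 2n - 3 while opt(F) = N + 1 = n.
  path-lower-bound : 2 ≤ N → LowerBoundAt (suc N) (q 1) d
  path-lower-bound 2≤N =
    F , (N ∸ 1) + N , suc N , algorithm-cost 1≤N , sweep-optimal 2≤N , inj₂ (not-singleton , ratio)
    where
    1≤N : 1 ≤ N
    1≤N = <⇒≤ 2≤N
    not-singleton : ¬ CSingleton F (q 1)
    not-singleton single = 0≢1+n (q-injective z≤n 1≤N (single (q 0) (path-in-component 1≤N z≤n)))
    ratio : (2 * suc N ∸ 3) * suc N ≤ suc N * ((N ∸ 1) + N)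
    ratio = ≤-reflexive (trans (cong (_* suc N) (double-minus-three N 1≤N)) (*-comm _ (suc N)))

-- Main theorem: start the path one step before v, so that v = q 1.
lemma2p1 : (n : ℕ) → 3 ≤ n → (v : Fin n) → (d : Dir) →
    Σ (FaultConfig n) λ F → Σ ℕ λ c → Σ ℕ λ o →
      IsAlgCost F v d c × IsOpt F v o × RatioAtLeast F v c o (2 * n ∸ 3) n
lemma2p1 (suc N) (s≤s 2≤N) v d =
  subst (λ u → LowerBoundAt (suc N) u d) (forth-and-back d v)
        (Path.path-lower-bound d (target v (opp d)) 2≤N)
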